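{- The Struction Rule generalizes the 2-Clique Neighborhood Rule: for every Vertex Cover instance $(G,k)$ and every instance $(G',k')$ obtained from $(G,k)$ by applying the 2-Clique Neighborhood Rule to a vertex $v$, applying the Struction Rule to $v$ (with a suitable ordering of $N(v)$) yields an instance $(G'',k')$ with $G''$ isomorphic to $G'$.
   Context: Instances are pairs $(G,k)$ with $G=(V,E)$ a simple undirected graph and $k$ an integer (Vertex Cover). 2-Clique Neighborhood Rule: let $v$ be a vertex with a partition $(C_1,C_2)$ of $N(v)$ such that $|C_1|\ge|C_2|$, $C_1$ and $C_2$ are cliques, and, with $M$ the set of non-edges of $G[N(v)]$, each $c_1\in C_1$ lies in exactly one pair of $M$; then delete $v$ and $C_2$, for every $\{c_1,c_2\}\in M$ with $c_1\in C_1,c_2\in C_2$ add all missing edges between $c_1$ and $N_G(c_2)$ (among remaining vertices), and decrease $k$ by $|C_2|$. Struction Rule applied to a vertex $v$ with $N(v)=\{a_1,\dots,a_d\}$ (in some order) and $R=V\setminus N[v]$: remove $N[v]$; add new vertices $W=\{v_{i,j}\mid 1\le i<j\le d,\ \{a_i,a_j\}\notin E\}$; for $v_{i,j},v_{k,l}\in W$ add the edge $\{v_{i,j},v_{k,l}\}$ if $i\ne k$ or $\{a_j,a_l\}\in E$; for $v_{i,j}\in W$ and $u\in R$ add the edge $\{v_{i,j},u\}$ if $\{a_i,u\}\in E$ or $\{a_j,u\}\in E$; set $k'=k+|W|-d$. -}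

module Defs where

open import Data.Nat using (ℕ; _≤_)
open import Data.Integer as ℤ using (ℤ; +_)
open import Data.Fin as F using (Fin)
open import Data.Fin.Subset using (Subset; _∈_; _∉_; ∣_∣)
open import Data.Bool using (Bool; true; false)
open import Data.Product using (Σ; ∃; ∃!; _×_; _,_)
open import Data.Sum using (_⊎_; inj₁; inj₂)
open import Relation.Binary.PropositionalEquality using (_≡_; _≢_)
open import Function.Bundles using (_↔_; _⇔_; Inverse)

record Graph (n : ℕ) : Set where
  field
    adj        : Fin n → Fin n → Bool
    adj-sym    : ∀ x y → adj x y ≡ adj y x
    adj-irrefl : ∀ x → adj x x ≡ false

module _ {n : ℕ} (G : Graph n) where
  open Graph G

  Edge : Fin n → Fin n → Set
  Edge x y = adj x y ≡ true

  record TwoCliqueApplicable (v : Fin n) (C₁ C₂ : Subset n) : Set where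
    field
      cover    : ∀ u → Edge v u ⇔ (u ∈ C₁ ⊎ u ∈ C₂)
      disjoint : ∀ u → u ∈ C₁ → u ∉ C₂
      size     : ∣ C₂ ∣ ≤ ∣ C₁ ∣
      clique₁  : ∀ x y → x ∈ C₁ → y ∈ C₁ → x ≢ y → Edge x y
      clique₂  : ∀ x y → x ∈ C₂ → y ∈ C₂ → x ≢ y → Edge x y
      unique-nonedge : ∀ c → c ∈ C₁ →
        ∃! _≡_ (λ w → Edge v w × w ≢ c × adj c w ≡ false)

  TwoCliqueV : Fin n → Subset n → Set
  TwoCliqueV v C₂ = Σ (Fin n) λ u → u ≢ v × u ∉ C₂

  -- new edge from c₁ ∈ C₁ to y ∈ N_G(c₂), for a non-edge {c₁,c₂} ∈ M
  Added : Subset n → Subset n → Fin n → Fin n → Set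
  Added C₁ C₂ x y =
    x ∈ C₁ × Σ (Fin n) λ c₂ → c₂ ∈ C₂ × adj x c₂ ≡ false × Edge c₂ y

  TwoCliqueE : (v : Fin n) (C₁ C₂ : Subset n) →
               TwoCliqueV v C₂ → TwoCliqueV v C₂ → Set
  TwoCliqueE v C₁ C₂ (x , _) (y , _) =
    Edge x y ⊎ Added C₁ C₂ x y ⊎ Added C₁ C₂ y x

  record IsNbrOrdering (v : Fin n) {d : ℕ} (a : Fin d → Fin n) : Set where
    field
      injective : ∀ i j → a i ≡ a j → i ≡ j
      onto      : ∀ u → Edge v u ⇔ ∃ (λ i → a i ≡ u)

  StrW : {d : ℕ} → (Fin d → Fin n) → Set
  StrW {d} a = Σ (Fin d × Fin d) λ { (i , j) → i F.< j × adj (a i) (a j) ≡ false }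

  StrR : Fin n → Set
  StrR v = Σ (Fin n) λ u → u ≢ v × adj v u ≡ false

  StructionV : Fin n → {d : ℕ} → (Fin d → Fin n) → Set
  StructionV v a = StrW a ⊎ StrR v

  StructionE : (v : Fin n) {d : ℕ} (a : Fin d → Fin n) →
               StructionV v a → StructionV v a → Set
  StructionE v a (inj₁ ((i , j) , _)) (inj₁ ((k , l) , _)) = i ≢ k ⊎ Edge (a j) (a l)
  StructionE v a (inj₁ ((i , j) , _)) (inj₂ (u , _)) = Edge (a i) u ⊎ Edge (a j) u
  StructionE v a (inj₂ (u , _)) (inj₁ ((i , j) , _)) = Edge (a i) u ⊎ Edge (a j) u
  StructionE v a (inj₂ (u , _)) (inj₂ (w , _)) = Edge u w

Isomorphic : {V W : Set} → (V → V → Set) → (W → W → Set) → Set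
Isomorphic {V} {W} E₁ E₂ =
  Σ (V ↔ W) λ f → ∀ x y → E₁ x y ⇔ E₂ (Inverse.to f x) (Inverse.to f y)

-- List N(v) as C₂ followed by C₁. Since C₁ and C₂ are cliques, the non-adjacent
-- pairs a_i, a_j with i < j are exactly those with a_i ∈ C₂ and a_j ∈ C₁, and
-- a_j ∈ C₁ determines a_i as its unique non-neighbour in N(v). Hence the new
-- vertex v_{i,j} of the struction can be identified with a_j ∈ C₁: this gives
-- |W| = |C₁|, a vertex bijection W ∪ R ≅ C₁ ∪ R = V ∖ ({v} ∪ C₂), and the edge
-- rule of the struction at v_{i,j} (neighbours of a_i or of a_j) becomes the
-- edges of a_j together with the edges added from a_j by the 2-clique rule.
module Submission where

open import Defs
open import Data.Nat using (ℕ)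
open import Data.Integer using (ℤ; +_; _+_; _-_)
open import Data.Fin using (Fin)
open import Data.Fin.Subset using (Subset; ∣_∣)
open import Data.Product using (Σ; _×_)
open import Relation.Binary.PropositionalEquality using (_≡_)
open import Function.Bundles using (_↔_)

import Data.Nat as ℕ
open import Data.Nat.Properties
  using (<-irrefl; <-trans; <-≤-trans; m≤m+n; <-irrelevant)
open import Data.Integer.Properties using (pos-+)
open import Data.Integer.Tactic.RingSolver using (solve-∀)
open import Data.Fin using (zero; suc; toℕ; splitAt; _↑ˡ_; _↑ʳ_)
import Data.Fin as Fin
open import Data.Fin.Properties
  using (toℕ<n; toℕ-↑ˡ; toℕ-↑ʳ; splitAt-↑ˡ; splitAt-↑ʳ; splitAt⁻¹-↑ˡ; splitAt⁻¹-↑ʳ)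
open import Data.Fin.Subset using (_∈_; _∉_; inside; outside)
open import Data.Fin.Subset.Properties using (_∈?_)
open import Data.Vec using (_∷_; here; there)
open import Data.Vec.Properties.WithK using ([]=-irrelevant)
open import Data.Bool using (false)
import Data.Bool.Properties as Bool
open import Axiom.UniquenessOfIdentityProofs using (module Decidable⇒UIP)
open import Data.Product using (_,_; proj₁; proj₂; ∃)
open import Data.Sum using (_⊎_; inj₁; inj₂; [_,_]′; swap)
open import Data.Sum.Function.Propositional using (_⊎-cong_)
open import Data.Empty using (⊥-elim)
open import Relation.Nullary using (¬_; yes; no)
open import Relation.Binary.PropositionalEquality
  using (refl; sym; trans; cong; cong₂; subst; subst₂; _≢_; module ≡-Reasoning)
open import Function using (id; _∘_)
open import Function.Bundles using (Inverse; Equivalence; _⇔_; mk↔ₛ′; mk⇔)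
open import Function.Properties.Inverse using (↔-refl; ↔-sym; ↔-trans)
import Function.Properties.Equivalence as ⇔

k+n-[m+n]≡k-m : ∀ (k : ℤ) (m n : ℕ) → k + + n - + (m ℕ.+ n) ≡ k - + m
k+n-[m+n]≡k-m k m n rewrite pos-+ m n = ring k (+ m) (+ n)
  where
  ring : ∀ (k m n : ℤ) → k + n - (m + n) ≡ k - m
  ring = solve-∀

≡false-irrelevant : ∀ {b} (p q : b ≡ false) → p ≡ q
≡false-irrelevant = Decidable⇒UIP.≡-irrelevant Bool._≟_

data Split (m n : ℕ) : Fin (m ℕ.+ n) → Set where
  left  : (i : Fin m) → Split m n (i ↑ˡ n)
  right : (j : Fin n) → Split m n (m ↑ʳ j)

split : ∀ m {n} (x : Fin (m ℕ.+ n)) → Split m n x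
split m x with splitAt m x in eq
... | inj₁ i = subst (Split m _) (splitAt⁻¹-↑ˡ eq) (left i)
... | inj₂ j = subst (Split m _) (splitAt⁻¹-↑ʳ eq) (right j)

enumerate : ∀ {n} (S : Subset n) → Fin ∣ S ∣ → Fin n
enumerate (inside  ∷ S) zero    = zero
enumerate (inside  ∷ S) (suc i) = suc (enumerate S i)
enumerate (outside ∷ S) i       = suc (enumerate S i)

enumerate-∈ : ∀ {n} (S : Subset n) i → enumerate S i ∈ S
enumerate-∈ (inside  ∷ S) zero    = here
enumerate-∈ (inside  ∷ S) (suc i) = there (enumerate-∈ S i)
enumerate-∈ (outside ∷ S) i       = there (enumerate-∈ S i)

position : ∀ {n} {S : Subset n} {x} → x ∈ S → Fin ∣ S ∣
position {S = inside  ∷ S} here      = zero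
position {S = inside  ∷ S} (there p) = suc (position p)
position {S = outside ∷ S} (there p) = position p

enumerate-position : ∀ {n} {S : Subset n} {x} (x∈S : x ∈ S) →
                     enumerate S (position x∈S) ≡ x
enumerate-position {S = inside  ∷ S} here      = refl
enumerate-position {S = inside  ∷ S} (there p) = cong suc (enumerate-position p)
enumerate-position {S = outside ∷ S} (there p) = cong suc (enumerate-position p)

position-enumerate : ∀ {n} (S : Subset n) i (x∈S : enumerate S i ∈ S) →
                     position x∈S ≡ i
position-enumerate (inside  ∷ S) zero    here      = refl
position-enumerate (inside  ∷ S) (suc i) (there p) = cong suc (position-enumerate S i p)
position-enumerate (outside ∷ S) i       (there p) = position-enumerate S i p

Member : ∀ {n} → Subset n → Set
Member {n} S = Σ (Fin n) (_∈ S)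

member-≡ : ∀ {n} {S : Subset n} {x y} {x∈S : x ∈ S} {y∈S : y ∈ S} →
           x ≡ y → _≡_ {A = Member S} (x , x∈S) (y , y∈S)
member-≡ refl = cong (_ ,_) ([]=-irrelevant _ _)

enumerate↔ : ∀ {n} (S : Subset n) → Fin ∣ S ∣ ↔ Member S
enumerate↔ S = mk↔ₛ′ (λ i → enumerate S i , enumerate-∈ S i) (λ (_ , x∈S) → position x∈S)
  (λ (_ , x∈S) → member-≡ (enumerate-position x∈S))
  (λ i → position-enumerate S i (enumerate-∈ S i))

enumerate-injective : ∀ {n} (S : Subset n) {i j} → enumerate S i ≡ enumerate S j → i ≡ j
enumerate-injective S {i} {j} e =
  trans (sym (position-enumerate S i (enumerate-∈ S i)))
        (trans (cong (λ (_ , x∈S) → position x∈S)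
                     (member-≡ {x∈S = enumerate-∈ S i} {y∈S = enumerate-∈ S j} e))
               (position-enumerate S j (enumerate-∈ S j)))

module _ {n} (S T : Subset n) where

  enumerate-++ : Fin (∣ S ∣ ℕ.+ ∣ T ∣) → Fin n
  enumerate-++ x = [ enumerate S , enumerate T ]′ (splitAt ∣ S ∣ x)

  enumerate-++-↑ˡ : ∀ i → enumerate-++ (i ↑ˡ ∣ T ∣) ≡ enumerate S i
  enumerate-++-↑ˡ i rewrite splitAt-↑ˡ (∣ S ∣) i (∣ T ∣) = refl

  enumerate-++-↑ʳ : ∀ j → enumerate-++ (∣ S ∣ ↑ʳ j) ≡ enumerate T j
  enumerate-++-↑ʳ j rewrite splitAt-↑ʳ (∣ S ∣) (∣ T ∣) j = refl

  enumerate-++-positionˡ : ∀ {x} (x∈S : x ∈ S) → enumerate-++ (position x∈S ↑ˡ ∣ T ∣) ≡ x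
  enumerate-++-positionˡ x∈S = trans (enumerate-++-↑ˡ _) (enumerate-position x∈S)

  enumerate-++-positionʳ : ∀ {x} (x∈T : x ∈ T) → enumerate-++ (∣ S ∣ ↑ʳ position x∈T) ≡ x
  enumerate-++-positionʳ x∈T = trans (enumerate-++-↑ʳ _) (enumerate-position x∈T)

  enumerate-++-∈ : ∀ x → (enumerate-++ x ∈ S × toℕ x ℕ.< ∣ S ∣) ⊎
                         (enumerate-++ x ∈ T × ∣ S ∣ ℕ.≤ toℕ x)
  enumerate-++-∈ x with split ∣ S ∣ x
  ... | left i  = inj₁ ( subst (_∈ S) (sym (enumerate-++-↑ˡ i)) (enumerate-∈ S i)
                       , subst (ℕ._< ∣ S ∣) (sym (toℕ-↑ˡ i (∣ T ∣))) (toℕ<n i))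
  ... | right j = inj₂ ( subst (_∈ T) (sym (enumerate-++-↑ʳ j)) (enumerate-∈ T j)
                       , subst (∣ S ∣ ℕ.≤_) (sym (toℕ-↑ʳ (∣ S ∣) j)) (m≤m+n _ _))

  enumerate-++-onto : ∀ {x} → x ∈ S ⊎ x ∈ T → ∃ λ i → enumerate-++ i ≡ x
  enumerate-++-onto (inj₁ x∈S) = _ , enumerate-++-positionˡ x∈S
  enumerate-++-onto (inj₂ x∈T) = _ , enumerate-++-positionʳ x∈T

  enumerate-++-injective : (∀ x → x ∈ S → x ∉ T) →
                           ∀ i j → enumerate-++ i ≡ enumerate-++ j → i ≡ j
  enumerate-++-injective disjoint i j e with split ∣ S ∣ i | split ∣ S ∣ j
  ... | left i  | left j  = cong (_↑ˡ ∣ T ∣) (enumerate-injective S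
    (trans (sym (enumerate-++-↑ˡ i)) (trans e (enumerate-++-↑ˡ j))))
  ... | right i | right j = cong (∣ S ∣ ↑ʳ_) (enumerate-injective T
    (trans (sym (enumerate-++-↑ʳ i)) (trans e (enumerate-++-↑ʳ j))))
  ... | left i  | right j = ⊥-elim (disjoint _ (enumerate-∈ S i)
    (subst (_∈ T) (trans (sym (enumerate-++-↑ʳ j)) (trans (sym e) (enumerate-++-↑ˡ i)))
           (enumerate-∈ T j)))
  ... | right i | left j  = ⊥-elim (disjoint _ (enumerate-∈ S j)
    (subst (_∈ T) (trans (sym (enumerate-++-↑ʳ i)) (trans e (enumerate-++-↑ˡ j)))
           (enumerate-∈ T i)))

module _ {n} (G : Graph n) where
  open Graph G

  edge⇒≢ : ∀ {x y} → Edge G x y → x ≢ y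
  edge⇒≢ {x} e refl = Bool.not-¬ e (adj-irrefl x)

  Added-irrefl : ∀ {S T x} → ¬ Added G S T x x
  Added-irrefl {x = x} (_ , c₂ , _ , ¬xc₂ , c₂x) = Bool.not-¬ (trans (adj-sym x c₂) c₂x) ¬xc₂

  StrW-≡ : ∀ {d} {a : Fin d → Fin n} {w w′ : StrW G a} → proj₁ w ≡ proj₁ w′ → w ≡ w′
  StrW-≡ {w = ij , i<j , ¬ij} {w′ = .ij , i<j′ , ¬ij′} refl =
    cong₂ (λ p q → ij , p , q) (<-irrelevant i<j i<j′) (≡false-irrelevant ¬ij ¬ij′)

module TwoCliqueToStruction {n} (G : Graph n) (v : Fin n) (C₁ C₂ : Subset n)
                            (A : TwoCliqueApplicable G v C₁ C₂) where
  open Graph G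
  open TwoCliqueApplicable A

  d : ℕ
  d = ∣ C₂ ∣ ℕ.+ ∣ C₁ ∣

  a : Fin d → Fin n
  a = enumerate-++ C₂ C₁

  ∈C⇒∈N : ∀ {u} → u ∈ C₁ ⊎ u ∈ C₂ → Edge G v u
  ∈C⇒∈N {u} = Equivalence.from (cover u)

  ∉N⇒∉C₁ : ∀ {u} → adj v u ≡ false → u ∉ C₁
  ∉N⇒∉C₁ ¬vu u∈C₁ = Bool.not-¬ (∈C⇒∈N (inj₁ u∈C₁)) ¬vu

  ∉N⇒∉C₂ : ∀ {u} → adj v u ≡ false → u ∉ C₂
  ∉N⇒∉C₂ ¬vu u∈C₂ = Bool.not-¬ (∈C⇒∈N (inj₂ u∈C₂)) ¬vu

  a-injective : ∀ i j → a i ≡ a j → i ≡ j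
  a-injective = enumerate-++-injective C₂ C₁ (λ u u∈C₂ u∈C₁ → disjoint u u∈C₁ u∈C₂)

  a-∈C : ∀ i → a i ∈ C₁ ⊎ a i ∈ C₂
  a-∈C i = [ inj₂ ∘ proj₁ , inj₁ ∘ proj₁ ]′ (enumerate-++-∈ C₂ C₁ i)

  a-<⇒≢ : ∀ {i j} → i Fin.< j → a i ≢ a j
  a-<⇒≢ i<j e with a-injective _ _ e
  ... | refl = <-irrefl refl i<j

  ordering : IsNbrOrdering G v a
  ordering = record
    { injective = a-injective
    ; onto      = λ u → mk⇔
        (λ vu → enumerate-++-onto C₂ C₁ (swap (Equivalence.to (cover u) vu)))
        (λ { (i , refl) → ∈C⇒∈N (a-∈C i) })
    }

  IsPartner : Fin n → Fin n → Set
  IsPartner c w = Edge G v w × w ≢ c × adj c w ≡ false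

  partners-agree : ∀ {c w w′} → c ∈ C₁ → IsPartner c w → IsPartner c w′ → w ≡ w′
  partners-agree {c} c∈C₁ p p′ with unique-nonedge c c∈C₁
  ... | _ , _ , unique = trans (sym (unique p)) (unique p′)

  partner : ∀ {c} → c ∈ C₁ → Fin n
  partner {c} c∈C₁ = proj₁ (unique-nonedge c c∈C₁)

  partner-isPartner : ∀ {c} (c∈C₁ : c ∈ C₁) → IsPartner c (partner c∈C₁)
  partner-isPartner {c} c∈C₁ = proj₁ (proj₂ (unique-nonedge c c∈C₁))

  partner-unique : ∀ {c w} (c∈C₁ : c ∈ C₁) → IsPartner c w → partner c∈C₁ ≡ w
  partner-unique c∈C₁ = partners-agree c∈C₁ (partner-isPartner c∈C₁)

  partner-∈C₂ : ∀ {c} (c∈C₁ : c ∈ C₁) → partner c∈C₁ ∈ C₂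
  partner-∈C₂ {c} c∈C₁ with partner-isPartner c∈C₁
  ... | vw , w≢c , ¬cw with Equivalence.to (cover (partner c∈C₁)) vw
  ...   | inj₁ w∈C₁ = ⊥-elim (Bool.not-¬ (clique₁ c _ c∈C₁ w∈C₁ (λ c≡w → w≢c (sym c≡w))) ¬cw)
  ...   | inj₂ w∈C₂ = w∈C₂

  nonadjacent⇒isPartner : ∀ {c w} → c ∈ C₁ → w ∈ C₂ → adj c w ≡ false → IsPartner c w
  nonadjacent⇒isPartner c∈C₁ w∈C₂ ¬cw =
    ∈C⇒∈N (inj₂ w∈C₂) , (λ w≡c → disjoint _ c∈C₁ (subst (_∈ C₂) w≡c w∈C₂)) , ¬cw

  StrW-endpoints : ∀ {i j} → i Fin.< j → adj (a i) (a j) ≡ false → a i ∈ C₂ × a j ∈ C₁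
  StrW-endpoints {i} {j} i<j ¬ij with enumerate-++-∈ C₂ C₁ i | enumerate-++-∈ C₂ C₁ j
  ... | inj₁ (i∈C₂ , _)  | inj₂ (j∈C₁ , _) = i∈C₂ , j∈C₁
  ... | inj₁ (i∈C₂ , _)  | inj₁ (j∈C₂ , _) =
    ⊥-elim (Bool.not-¬ (clique₂ _ _ i∈C₂ j∈C₂ (a-<⇒≢ i<j)) ¬ij)
  ... | inj₂ (i∈C₁ , _)  | inj₂ (j∈C₁ , _) =
    ⊥-elim (Bool.not-¬ (clique₁ _ _ i∈C₁ j∈C₁ (a-<⇒≢ i<j)) ¬ij)
  ... | inj₂ (_ , C₂≤i) | inj₁ (_ , j<C₂) =
    ⊥-elim (<-irrefl refl (<-trans i<j (<-≤-trans j<C₂ C₂≤i)))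

  W-c₁ W-c₂ : StrW G a → Fin n
  W-c₁ ((_ , j) , _) = a j
  W-c₂ ((i , _) , _) = a i

  W-c₁-∈ : ∀ w → W-c₁ w ∈ C₁
  W-c₁-∈ (_ , i<j , ¬ij) = proj₂ (StrW-endpoints i<j ¬ij)

  W-c₂-isPartner : ∀ w → IsPartner (W-c₁ w) (W-c₂ w)
  W-c₂-isPartner w@((i , j) , i<j , ¬ij) =
    nonadjacent⇒isPartner (W-c₁-∈ w) (proj₁ (StrW-endpoints i<j ¬ij))
                          (trans (adj-sym (a j) (a i)) ¬ij)

  fromC₁ : ∀ {c} → c ∈ C₁ → StrW G a
  fromC₁ {c} c∈C₁ = (i , j) , i<j , ¬ij
    where
    i j : Fin d
    i = position (partner-∈C₂ c∈C₁) ↑ˡ ∣ C₁ ∣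
    j = ∣ C₂ ∣ ↑ʳ position c∈C₁
    i<j : i Fin.< j
    i<j = subst₂ ℕ._<_ (sym (toℕ-↑ˡ _ (∣ C₁ ∣))) (sym (toℕ-↑ʳ (∣ C₂ ∣) _))
                 (<-≤-trans (toℕ<n _) (m≤m+n _ _))
    ¬ij : adj (a i) (a j) ≡ false
    ¬ij = begin
      adj (a i) (a j)       ≡⟨ cong₂ adj (enumerate-++-positionˡ C₂ C₁ (partner-∈C₂ c∈C₁))
                                          (enumerate-++-positionʳ C₂ C₁ c∈C₁) ⟩
      adj (partner c∈C₁) c  ≡⟨ adj-sym _ c ⟩
      adj c (partner c∈C₁)  ≡⟨ proj₂ (proj₂ (partner-isPartner c∈C₁)) ⟩
      false                 ∎
      where open ≡-Reasoning

  W↔C₁ : StrW G a ↔ Member C₁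
  W↔C₁ = mk↔ₛ′ (λ w → W-c₁ w , W-c₁-∈ w) (λ (_ , c∈C₁) → fromC₁ c∈C₁)
    (λ (_ , c∈C₁) → member-≡ (enumerate-++-positionʳ C₂ C₁ c∈C₁))
    (λ w → StrW-≡ G (cong₂ _,_ (a-injective _ _ (c₂-matches w))
                               (a-injective _ _ (c₁-matches w))))
    where
    c₁-matches : ∀ w → W-c₁ (fromC₁ (W-c₁-∈ w)) ≡ W-c₁ w
    c₁-matches w = enumerate-++-positionʳ C₂ C₁ (W-c₁-∈ w)
    c₂-matches : ∀ w → W-c₂ (fromC₁ (W-c₁-∈ w)) ≡ W-c₂ w
    c₂-matches w = trans (enumerate-++-positionˡ C₂ C₁ (partner-∈C₂ (W-c₁-∈ w)))
                         (partner-unique (W-c₁-∈ w) (W-c₂-isPartner w))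

  C₁⊎R↔V′ : (Member C₁ ⊎ StrR G v) ↔ TwoCliqueV G v C₂
  C₁⊎R↔V′ = mk↔ₛ′ to from to∘from from∘to
    where
    to : Member C₁ ⊎ StrR G v → TwoCliqueV G v C₂
    to (inj₁ (c , c∈C₁)) =
      c , (λ c≡v → edge⇒≢ G (∈C⇒∈N (inj₁ c∈C₁)) (sym c≡v)) , disjoint c c∈C₁
    to (inj₂ (u , u≢v , ¬vu)) = u , u≢v , ∉N⇒∉C₂ ¬vu
    from : TwoCliqueV G v C₂ → Member C₁ ⊎ StrR G v
    from (u , u≢v , u∉C₂) with u ∈? C₁
    ... | yes u∈C₁ = inj₁ (u , u∈C₁)
    ... | no  u∉C₁ =
      inj₂ (u , u≢v , Bool.¬-not (λ vu → [ u∉C₁ , u∉C₂ ]′ (Equivalence.to (cover u) vu)))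
    -- The ≢ and ∉ components agree definitionally: ⊥ is a record with an irrelevant field.
    to∘from : ∀ x → to (from x) ≡ x
    to∘from (u , _ , _) with u ∈? C₁
    ... | yes _ = refl
    ... | no  _ = refl
    from∘to : ∀ x → from (to x) ≡ x
    from∘to (inj₁ (c , c∈C₁)) with c ∈? C₁
    ... | yes _    = cong inj₁ (member-≡ refl)
    ... | no  c∉C₁ = ⊥-elim (c∉C₁ c∈C₁)
    from∘to (inj₂ (u , u≢v , ¬vu)) with u ∈? C₁
    ... | yes u∈C₁ = ⊥-elim (∉N⇒∉C₁ ¬vu u∈C₁)
    ... | no  _    = cong (λ ¬vu′ → inj₂ (u , u≢v , ¬vu′))
                          (≡false-irrelevant _ ¬vu)

  vertices : StructionV G v a ↔ TwoCliqueV G v C₂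
  vertices = ↔-trans (W↔C₁ ⊎-cong ↔-refl) C₁⊎R↔V′

  Edge′ : Fin n → Fin n → Set
  Edge′ x y = Edge G x y ⊎ Added G C₁ C₂ x y ⊎ Added G C₁ C₂ y x

  Edge′-sym : ∀ {x y} → Edge′ x y ⇔ Edge′ y x
  Edge′-sym = mk⇔ flip flip
    where
    flip : ∀ {x y} → Edge′ x y → Edge′ y x
    flip {x} {y} (inj₁ e)         = inj₁ (trans (adj-sym y x) e)
    flip         (inj₂ (inj₁ ad)) = inj₂ (inj₂ ad)
    flip         (inj₂ (inj₂ ad)) = inj₂ (inj₁ ad)

  Edge′-irrefl : ∀ x → ¬ Edge′ x x
  Edge′-irrefl x (inj₁ e) = edge⇒≢ G e refl
  Edge′-irrefl x (inj₂ (inj₁ ad)) = Added-irrefl G ad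
  Edge′-irrefl x (inj₂ (inj₂ ad)) = Added-irrefl G ad

  Edge′-within-C₁ : ∀ {x y} → x ∈ C₁ → y ∈ C₁ → Edge′ x y ⇔ x ≢ y
  Edge′-within-C₁ {x} x∈C₁ y∈C₁ = mk⇔
    (λ e x≡y → Edge′-irrefl x (subst (Edge′ x) (sym x≡y) e))
    (inj₁ ∘ clique₁ _ _ x∈C₁ y∈C₁)

  Edge′-outside-C₁ : ∀ {x y} → x ∉ C₁ → y ∉ C₁ → Edge′ x y ⇔ Edge G x y
  Edge′-outside-C₁ x∉C₁ y∉C₁ =
    mk⇔ [ id , [ ⊥-elim ∘ x∉C₁ ∘ proj₁ , ⊥-elim ∘ y∉C₁ ∘ proj₁ ]′ ]′ inj₁

  Edge′-C₁-outside : ∀ {c u} (c∈C₁ : c ∈ C₁) → u ∉ C₁ →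
                     Edge′ c u ⇔ (Edge G (partner c∈C₁) u ⊎ Edge G c u)
  Edge′-C₁-outside {c} {u} c∈C₁ u∉C₁ = mk⇔ to from
    where
    to : Edge′ c u → Edge G (partner c∈C₁) u ⊎ Edge G c u
    to (inj₁ e) = inj₂ e
    to (inj₂ (inj₁ (_ , c₂ , c₂∈C₂ , ¬cc₂ , c₂u))) =
      inj₁ (subst (λ z → Edge G z u)
                  (sym (partner-unique c∈C₁ (nonadjacent⇒isPartner c∈C₁ c₂∈C₂ ¬cc₂))) c₂u)
    to (inj₂ (inj₂ (u∈C₁ , _))) = ⊥-elim (u∉C₁ u∈C₁)
    from : Edge G (partner c∈C₁) u ⊎ Edge G c u → Edge′ c u
    from (inj₁ e) = inj₂ (inj₁ (c∈C₁ , partner c∈C₁ , partner-∈C₂ c∈C₁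
                                , proj₂ (proj₂ (partner-isPartner c∈C₁)) , e))
    from (inj₂ e) = inj₁ e

  -- v_{i,j} and v_{k,l} are non-adjacent iff i = k and a_j = a_l, i.e. iff they coincide.
  W-adjacent : ∀ w w′ → StructionE G v a (inj₁ w) (inj₁ w′) ⇔ W-c₁ w ≢ W-c₁ w′
  W-adjacent w@((i , j) , _) w′@((k , l) , _) = mk⇔
    [ (λ i≢k aj≡al → i≢k (a-injective i k (partners-agree (W-c₁-∈ w) (W-c₂-isPartner w)
        (subst (λ c → IsPartner c (a k)) (sym aj≡al) (W-c₂-isPartner w′)))))
    , edge⇒≢ G
    ]′
    (inj₂ ∘ clique₁ _ _ (W-c₁-∈ w) (W-c₁-∈ w′))

  WR-adjacent : ∀ w (r : StrR G v) →
                StructionE G v a (inj₁ w) (inj₂ r) ⇔ Edge′ (W-c₁ w) (proj₁ r)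
  WR-adjacent w (u , _ , ¬vu) =
    subst (λ c₂ → (Edge G c₂ u ⊎ Edge G (W-c₁ w) u) ⇔ Edge′ (W-c₁ w) u)
          (partner-unique (W-c₁-∈ w) (W-c₂-isPartner w))
          (⇔.sym (Edge′-C₁-outside (W-c₁-∈ w) (∉N⇒∉C₁ ¬vu)))

  edges : ∀ x y → StructionE G v a x y ⇔
                  TwoCliqueE G v C₁ C₂ (Inverse.to vertices x) (Inverse.to vertices y)
  edges (inj₁ w) (inj₁ w′) =
    ⇔.trans (W-adjacent w w′) (⇔.sym (Edge′-within-C₁ (W-c₁-∈ w) (W-c₁-∈ w′)))
  edges (inj₁ w) (inj₂ r)  = WR-adjacent w r
  edges (inj₂ r) (inj₁ w)  = ⇔.trans (WR-adjacent w r) Edge′-sym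
  edges (inj₂ (_ , _ , ¬vu)) (inj₂ (_ , _ , ¬vu′)) =
    ⇔.sym (Edge′-outside-C₁ (∉N⇒∉C₁ ¬vu) (∉N⇒∉C₁ ¬vu′))

  W↔Fin : StrW G a ↔ Fin ∣ C₁ ∣
  W↔Fin = ↔-trans W↔C₁ (↔-sym (enumerate↔ C₁))

lemma15 : ∀ {n : ℕ} (G : Graph n) (k : ℤ) (v : Fin n) (C₁ C₂ : Subset n) →
          TwoCliqueApplicable G v C₁ C₂ →
          Σ ℕ λ d → Σ (Fin d → Fin n) λ a →
            IsNbrOrdering G v a ×
            Isomorphic (StructionE G v a) (TwoCliqueE G v C₁ C₂) ×
            Σ ℕ λ m → (StrW G a ↔ Fin m) × (k + + m - + d ≡ k - + ∣ C₂ ∣)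
lemma15 G k v C₁ C₂ A =
  d , a , ordering , (vertices , edges) , ∣ C₁ ∣ , W↔Fin , k+n-[m+n]≡k-m k ∣ C₂ ∣ ∣ C₁ ∣
  where open TwoCliqueToStruction G v C₁ C₂ A
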